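{- Let $G$ and $H$ be vertex-disjoint balanced graphs, let $v_1\ne v_2$ be vertices of $G$ and $w_1\ne w_2$ be vertices of $H$. Let $G\bullet H$ be obtained from $G\cup H$ by identifying $v_1$ with $w_1$ and $v_2$ with $w_2$, and let $G\circ H$ be obtained from $G\cup H$ by identifying $v_1$ with $w_2$ and $v_2$ with $w_1$. Then $\mathcal{K}(G\bullet H)\simeq\mathcal{K}(G\circ H)$.
   Context: A graph is a finite directed multigraph. For $G=(V,E)$, $A$ is the $V\times V$ matrix with $A_{vw}$ the number of directed edges from $v$ to $w$, $\Delta$ is diagonal with $\Delta_{vv}=\sum_wA_{vw}$, $Q=\Delta-A$, $\dagger$ denotes transpose, and $\mathcal{K}(G)=\mathbf{Z}^V/Q^{\dagger}\mathbf{Z}^V$. A graph is balanced if it is strongly connected and each vertex has indegree equal to its outdegree. -}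

module Defs where

open import Data.Nat as ℕ using (ℕ; zero; suc)
open import Data.Integer as ℤ using (ℤ; +_)
open import Data.Fin as Fin using (Fin; splitAt; _↑ˡ_; _↑ʳ_)
open import Data.Fin.Properties using (_≟_)
open import Data.Sum using (_⊎_; inj₁; inj₂)
open import Data.Product using (_×_; ∃; _,_)
open import Relation.Nullary using (¬_; yes; no)
open import Relation.Binary.PropositionalEquality using (_≡_)
open import Function.Bundles using (_⇔_)

-- A finite directed multigraph on vertex set Fin n, given by its
-- adjacency matrix: A v w = number of directed edges from v to w.
Graph : ℕ → Set
Graph n = Fin n → Fin n → ℕ

sumℕ : ∀ {n} → (Fin n → ℕ) → ℕ
sumℕ {zero}  f = 0
sumℕ {suc n} f = f Fin.zero ℕ.+ sumℕ (λ i → f (Fin.suc i))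

sumℤ : ∀ {n} → (Fin n → ℤ) → ℤ
sumℤ {zero}  f = + 0
sumℤ {suc n} f = f Fin.zero ℤ.+ sumℤ (λ i → f (Fin.suc i))

outdeg : ∀ {n} → Graph n → Fin n → ℕ
outdeg A v = sumℕ (λ w → A v w)

indeg : ∀ {n} → Graph n → Fin n → ℕ
indeg A v = sumℕ (λ w → A w v)

data Reach {n} (A : Graph n) (v : Fin n) : Fin n → Set where
  here : Reach A v v
  step : ∀ {w u} → Reach A v w → 0 ℕ.< A w u → Reach A v u

StronglyConnected : ∀ {n} → Graph n → Set
StronglyConnected A = ∀ v w → Reach A v w

Balanced : ∀ {n} → Graph n → Set
Balanced A = StronglyConnected A × (∀ v → indeg A v ≡ outdeg A v)

Lap : ∀ {n} → Graph n → Fin n → Fin n → ℤ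
Lap A v w with v ≟ w
... | yes _ = + outdeg A v ℤ.- + A v w
... | no  _ = ℤ.- (+ A v w)

ℤVec : ℕ → Set
ℤVec n = Fin n → ℤ

QT : ∀ {n} → Graph n → ℤVec n → ℤVec n
QT A z v = sumℤ (λ w → Lap A w v ℤ.* z w)

-- congruence modulo the subgroup Q† Z^V; K(G) = Z^V / this relation
_≈K[_]_ : ∀ {n} → ℤVec n → Graph n → ℤVec n → Set
x ≈K[ A ] y = ∃ λ z → ∀ v → x v ℤ.- y v ≡ QT A z v

_+V_ : ∀ {n} → ℤVec n → ℤVec n → ℤVec n
(x +V y) v = x v ℤ.+ y v

-- a group homomorphism K(A) → K(B), represented by an additive map
-- Z^V → Z^W preserving the relations
IsKHom : ∀ {m n} → Graph m → Graph n → (ℤVec m → ℤVec n) → Set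
IsKHom A B f =
  (∀ x y v → f (x +V y) v ≡ f x v ℤ.+ f y v) ×
  (∀ x y → x ≈K[ A ] y → f x ≈K[ B ] f y)

_≅K_ : ∀ {m n} → Graph m → Graph n → Set
_≅K_ {m} {n} A B =
  ∃ λ (f : ℤVec m → ℤVec n) → ∃ λ (g : ℤVec n → ℤVec m) →
    IsKHom A B f × IsKHom B A g ×
    (∀ x → g (f x) ≈K[ A ] x) × (∀ y → f (g y) ≈K[ B ] y)

-- disjoint union G ∪ H on Fin (m + n): G's vertices first, then H's
_⊕_ : ∀ {m n} → Graph m → Graph n → Graph (m ℕ.+ n)
_⊕_ {m} G H x y with splitAt m x | splitAt m y
... | inj₁ i | inj₁ j = G i j
... | inj₂ i | inj₂ j = H i j
... | _      | _      = 0

Glue : ∀ {N} → (p₁ q₁ p₂ q₂ : Fin N) → Fin N → Fin N → Set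
Glue p₁ q₁ p₂ q₂ x y =
  x ≡ y
  ⊎ (x ≡ p₁ × y ≡ q₁) ⊎ (x ≡ q₁ × y ≡ p₁)
  ⊎ (x ≡ p₂ × y ≡ q₂) ⊎ (x ≡ q₂ × y ≡ p₂)

-- π : Fin N → Fin k is a quotient map for the identification
IsIdentification : ∀ {N k} → (p₁ q₁ p₂ q₂ : Fin N) → (Fin N → Fin k) → Set
IsIdentification p₁ q₁ p₂ q₂ π =
  (∀ a → ∃ λ x → π x ≡ a) ×
  (∀ x y → (π x ≡ π y) ⇔ Glue p₁ q₁ p₂ q₂ x y)

merge : ∀ {N k} → Graph N → (Fin N → Fin k) → Graph k
merge A π a b = sumℕ (λ x → sumℕ (λ y → h x y))
  where
  h : _ → _ → ℕ
  h x y with π x ≟ a | π y ≟ b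
  ... | yes _ | yes _ = A x y
  ... | _     | _     = 0

{-# OPTIONS --safe #-}
-- Write U = G ⊕ H and let π₊, π′₊ be the pushforwards ℤ^V(U) → ℤ^k, ℤ^k′ along the two
-- identifications. The Laplacian of a merged graph is a pushforward,
-- Q†(U/π) z = π₊ (Q†(U) (z ∘ π)), so K(U/π) is ℤ^V(U) modulo ker π₊ and the image of Q†(U) on
-- π-invariant potentials; likewise for π′. The involution reflectDiv of ℤ^V(U) negates the
-- H-coordinates of a divisor and puts their total at v₁ and v₂. It carries ker π₊, spanned by
-- e(v₁) − e(w₁) and e(v₂) − e(w₂), onto ker π′₊. Since H is balanced, constants are
-- Q†(H)-harmonic, so reflectDiv (Q†(U) u) = Q†(U) (reflectPot c u), where reflectPot c replaces
-- u by c − u on H; with c = u(w₁) + u(w₂) this swaps the values at w₁ and w₂ and turns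
-- π-invariant potentials into π′-invariant ones. Hence reflectDiv descends to an isomorphism
-- K(U/π) ≅ K(U/π′).
module Submission where

open import Defs
open import Data.Nat as ℕ using (ℕ; zero; suc)
open import Data.Integer as ℤ using (ℤ; +_; _+_; _*_; _-_; -_)
import Data.Integer.Properties as ℤP
open import Data.Integer.Tactic.RingSolver using (solve-∀)
open import Algebra.Properties.CommutativeSemigroup ℤP.+-commutativeSemigroup
  using () renaming (interchange to +-interchange)
open import Data.Fin using (Fin; zero; suc; splitAt; _↑ˡ_; _↑ʳ_)
open import Data.Fin.Properties
  using (_≟_; suc-injective; splitAt-↑ˡ; splitAt-↑ʳ; splitAt⁻¹-↑ˡ; splitAt⁻¹-↑ʳ; ↑ˡ-injective; ↑ʳ-injective)
open import Data.Vec.Functional using (_++_)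
open import Data.Vec.Functional.Properties using (lookup-++ˡ; lookup-++ʳ)
open import Data.Product using (_×_; ∃; _,_; proj₁; proj₂)
open import Data.Sum using (_⊎_; inj₁; inj₂; [_,_]′)
open import Data.Empty using (⊥-elim)
open import Function using (_∘_)
open import Function.Bundles using (Equivalence)
open import Relation.Nullary using (yes; no)
open import Relation.Binary.PropositionalEquality
open ≡-Reasoning

infixl 6 _-V_

_-V_ : ∀ {n} → ℤVec n → ℤVec n → ℤVec n
(x -V y) v = x v - y v

0V : ∀ {n} → ℤVec n
0V _ = + 0

sumℤ-cong : ∀ {n} {f g : Fin n → ℤ} → f ≗ g → sumℤ f ≡ sumℤ g
sumℤ-cong {zero}  f≗g = refl
sumℤ-cong {suc n} f≗g = cong₂ _+_ (f≗g zero) (sumℤ-cong (f≗g ∘ suc))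

sumℤ-zero : ∀ {n} {f : Fin n → ℤ} → f ≗ 0V → sumℤ f ≡ + 0
sumℤ-zero {zero}  f≗0 = refl
sumℤ-zero {suc n} f≗0 = cong₂ _+_ (f≗0 zero) (sumℤ-zero (f≗0 ∘ suc))

sumℤ-distrib-+ : ∀ {n} (f g : Fin n → ℤ) → sumℤ (f +V g) ≡ sumℤ f + sumℤ g
sumℤ-distrib-+ {zero}  f g = refl
sumℤ-distrib-+ {suc n} f g =
  trans (cong (_+_ (f zero + g zero)) (sumℤ-distrib-+ (f ∘ suc) (g ∘ suc)))
        (+-interchange (f zero) (g zero) _ _)

sumℤ-neg : ∀ {n} (f : Fin n → ℤ) → sumℤ (λ i → - f i) ≡ - sumℤ f
sumℤ-neg {zero}  f = refl
sumℤ-neg {suc n} f =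
  trans (cong (_+_ (- f zero)) (sumℤ-neg (f ∘ suc))) (sym (ℤP.neg-distrib-+ (f zero) _))

sumℤ-distrib-- : ∀ {n} (f g : Fin n → ℤ) → sumℤ (f -V g) ≡ sumℤ f - sumℤ g
sumℤ-distrib-- f g = trans (sumℤ-distrib-+ f (-_ ∘ g)) (cong (_+_ (sumℤ f)) (sumℤ-neg g))

*-distribˡ-sumℤ : ∀ {n} c (f : Fin n → ℤ) → c * sumℤ f ≡ sumℤ (λ i → c * f i)
*-distribˡ-sumℤ {zero}  c f = ℤP.*-zeroʳ c
*-distribˡ-sumℤ {suc n} c f =
  trans (ℤP.*-distribˡ-+ c (f zero) _) (cong (_+_ (c * f zero)) (*-distribˡ-sumℤ c (f ∘ suc)))

*-distribʳ-sumℤ : ∀ {n} c (f : Fin n → ℤ) → sumℤ f * c ≡ sumℤ (λ i → f i * c)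
*-distribʳ-sumℤ {zero}  c f = ℤP.*-zeroˡ c
*-distribʳ-sumℤ {suc n} c f =
  trans (ℤP.*-distribʳ-+ c (f zero) _) (cong (_+_ (f zero * c)) (*-distribʳ-sumℤ c (f ∘ suc)))

sumℤ-comm : ∀ {m n} (f : Fin m → Fin n → ℤ) →
            sumℤ (λ i → sumℤ (f i)) ≡ sumℤ (λ j → sumℤ (λ i → f i j))
sumℤ-comm {zero} {n} f = sym (sumℤ-zero {n} (λ _ → refl))
sumℤ-comm {suc m} f =
  trans (cong (_+_ (sumℤ (f zero))) (sumℤ-comm (f ∘ suc)))
        (sym (sumℤ-distrib-+ (f zero) (λ j → sumℤ (λ i → f (suc i) j))))

sumℤ-single : ∀ {n} {f : Fin n → ℤ} j → (∀ i → i ≢ j → f i ≡ + 0) → sumℤ f ≡ f j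
sumℤ-single {suc n} {f} zero    f₀ =
  trans (cong (_+_ (f zero)) (sumℤ-zero (λ i → f₀ (suc i) λ ()))) (ℤP.+-identityʳ _)
sumℤ-single {suc n} {f} (suc j) f₀ =
  trans (cong₂ _+_ (f₀ zero λ ()) (sumℤ-single j (λ i i≢j → f₀ (suc i) (i≢j ∘ suc-injective))))
        (ℤP.+-identityˡ _)

sumℤ-pair : ∀ {n} {f : Fin n → ℤ} {p q} → p ≢ q → (∀ i → i ≢ p → i ≢ q → f i ≡ + 0) →
            sumℤ f ≡ f p + f q
sumℤ-pair {suc n} {f} {zero}  {zero}  p≢q f₀ = ⊥-elim (p≢q refl)
sumℤ-pair {suc n} {f} {zero}  {suc q} p≢q f₀ =
  cong (_+_ (f zero)) (sumℤ-single q (λ i i≢q → f₀ (suc i) (λ ()) (i≢q ∘ suc-injective)))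
sumℤ-pair {suc n} {f} {suc p} {zero}  p≢q f₀ =
  trans (cong (_+_ (f zero)) (sumℤ-single p (λ i i≢p → f₀ (suc i) (i≢p ∘ suc-injective) (λ ()))))
        (ℤP.+-comm (f zero) (f (suc p)))
sumℤ-pair {suc n} {f} {suc p} {suc q} p≢q f₀ =
  trans (cong₂ _+_ (f₀ zero (λ ()) (λ ()))
                   (sumℤ-pair (p≢q ∘ cong suc)
                     (λ i i≢p i≢q → f₀ (suc i) (i≢p ∘ suc-injective) (i≢q ∘ suc-injective))))
        (ℤP.+-identityˡ _)

sumℤ-++ : ∀ m {n} (f : Fin (m ℕ.+ n) → ℤ) →
          sumℤ f ≡ sumℤ (λ a → f (a ↑ˡ n)) + sumℤ (λ j → f (m ↑ʳ j))
sumℤ-++ zero    f = sym (ℤP.+-identityˡ _)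
sumℤ-++ (suc m) f =
  trans (cong (_+_ (f zero)) (sumℤ-++ m (f ∘ suc))) (sym (ℤP.+-assoc (f zero) _ _))

sumℕ-sumℤ : ∀ {n} (f : Fin n → ℕ) → + sumℕ f ≡ sumℤ (λ i → + f i)
sumℕ-sumℤ {zero}  f = refl
sumℕ-sumℤ {suc n} f = trans (ℤP.pos-+ (f zero) _) (cong (_+_ (+ f zero)) (sumℕ-sumℤ (f ∘ suc)))

δ : ∀ {n} → Fin n → Fin n → ℤ
δ a b with a ≟ b
... | yes _ = + 1
... | no  _ = + 0

δ-≡ : ∀ {n} {a b : Fin n} → a ≡ b → δ a b ≡ + 1
δ-≡ {a = a} {b} a≡b with a ≟ b
... | yes _   = refl
... | no  a≢b = ⊥-elim (a≢b a≡b)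

δ-≢ : ∀ {n} {a b : Fin n} → a ≢ b → δ a b ≡ + 0
δ-≢ {a = a} {b} a≢b with a ≟ b
... | yes a≡b = ⊥-elim (a≢b a≡b)
... | no  _   = refl

δ-sym : ∀ {n} (a b : Fin n) → δ a b ≡ δ b a
δ-sym a b with a ≟ b | b ≟ a
... | yes _   | yes _   = refl
... | no  _   | no  _   = refl
... | yes a≡b | no  b≢a = ⊥-elim (b≢a (sym a≡b))
... | no  a≢b | yes b≡a = ⊥-elim (a≢b (sym b≡a))

δ-*-subst : ∀ {n} (a b : Fin n) (f : Fin n → ℤ) → δ a b * f a ≡ δ a b * f b
δ-*-subst a b f with a ≟ b
... | yes refl = refl
... | no  _    = refl

δ-*-≡ : ∀ {n} {a b : Fin n} → a ≡ b → ∀ c → δ a b * c ≡ c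
δ-*-≡ a≡b c = trans (cong (_* c) (δ-≡ a≡b)) (ℤP.*-identityˡ c)

δ-*-≢ : ∀ {n} {a b : Fin n} → a ≢ b → ∀ c → δ a b * c ≡ + 0
δ-*-≢ a≢b c = cong (_* c) (δ-≢ a≢b)

sumℤ-δ : ∀ {n} (j : Fin n) (f : Fin n → ℤ) → sumℤ (λ i → δ i j * f i) ≡ f j
sumℤ-δ j f = trans (sumℤ-single j (λ i i≢j → δ-*-≢ i≢j (f i))) (δ-*-≡ {a = j} refl (f j))

sumℤ-δ′ : ∀ {n} (j : Fin n) (f : Fin n → ℤ) → sumℤ (λ i → δ j i * f i) ≡ f j
sumℤ-δ′ j f = trans (sumℤ-cong (λ i → cong (_* f i) (δ-sym j i))) (sumℤ-δ j f)

record IsLinear {m n} (f : ℤVec m → ℤVec n) : Set where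
  field
    cong-≗ : ∀ {x y} → x ≗ y → f x ≗ f y
    +-hom  : ∀ x y → f (x +V y) ≗ f x +V f y

  -V-hom : ∀ x y → f (x -V y) ≗ f x -V f y
  -V-hom x y v = begin
    f (x -V y) v                   ≡⟨ a≡a+b-b (f (x -V y) v) (f y v) ⟩
    f (x -V y) v + f y v - f y v   ≡⟨ cong (_- f y v) (+-hom (x -V y) y v) ⟨
    f ((x -V y) +V y) v - f y v    ≡⟨ cong (_- f y v) (cong-≗ (λ w → a-b+b≡a (x w) (y w)) v) ⟩
    f x v - f y v                  ∎
    where
    a≡a+b-b : ∀ a b → a ≡ a + b - b
    a≡a+b-b = solve-∀
    a-b+b≡a : ∀ a b → a - b + b ≡ a
    a-b+b≡a = solve-∀

∘-linear : ∀ {l m n} {f : ℤVec m → ℤVec n} {g : ℤVec l → ℤVec m} →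
           IsLinear f → IsLinear g → IsLinear (f ∘ g)
∘-linear f-lin g-lin = record
  { cong-≗ = λ x≗y → F.cong-≗ (G.cong-≗ x≗y)
  ; +-hom  = λ x y v → trans (F.cong-≗ (G.+-hom x y) v) (F.+-hom _ _ v)
  }
  where
  module F = IsLinear f-lin
  module G = IsLinear g-lin

infixr 7 _ᵀ·_

_ᵀ·_ : ∀ {m n} → (Fin m → Fin n → ℤ) → ℤVec m → ℤVec n
(M ᵀ· x) v = sumℤ (λ w → M w v * x w)

ᵀ·-linear : ∀ {m n} (M : Fin m → Fin n → ℤ) → IsLinear (M ᵀ·_)
ᵀ·-linear M = record
  { cong-≗ = λ x≗y v → sumℤ-cong (λ w → cong (M w v *_) (x≗y w))
  ; +-hom  = λ x y v → trans (sumℤ-cong (λ w → ℤP.*-distribˡ-+ (M w v) (x w) (y w)))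
                             (sumℤ-distrib-+ (λ w → M w v * x w) (λ w → M w v * y w))
  }

ᵀ·-sumℤ : ∀ {l m n} (M : Fin m → Fin n → ℤ) (F : Fin l → ℤVec m) v →
          sumℤ (λ b → (M ᵀ· F b) v) ≡ (M ᵀ· (λ w → sumℤ (λ b → F b w))) v
ᵀ·-sumℤ M F v = begin
  sumℤ (λ b → sumℤ (λ w → M w v * F b w))   ≡⟨ sumℤ-comm (λ b w → M w v * F b w) ⟩
  sumℤ (λ w → sumℤ (λ b → M w v * F b w))   ≡⟨ sumℤ-cong (λ w → *-distribˡ-sumℤ (M w v) (λ b → F b w)) ⟨
  sumℤ (λ w → M w v * sumℤ (λ b → F b w))   ∎

-- Laplacians, pushforwards and merged graphs

QT-linear : ∀ {n} (A : Graph n) → IsLinear (QT A)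
QT-linear A = ᵀ·-linear (Lap A)

Lap-δ : ∀ {n} (A : Graph n) v w → Lap A v w ≡ δ v w * + outdeg A v - + A v w
Lap-δ A v w with v ≟ w
... | yes _ = cong (_- + A v w) (sym (ℤP.*-identityˡ (+ outdeg A v)))
... | no  _ = sym (ℤP.+-identityˡ _)

QT-expand : ∀ {n} (A : Graph n) z v → QT A z v ≡ + outdeg A v * z v - sumℤ (λ w → + A w v * z w)
QT-expand A z v = begin
  sumℤ (λ w → Lap A w v * z w)
    ≡⟨ sumℤ-cong (λ w → trans (cong (_* z w) (Lap-δ A w v)) (distrib (δ w v) _ _ _)) ⟩
  sumℤ (λ w → δ w v * (+ outdeg A w * z w) - + A w v * z w)
    ≡⟨ sumℤ-distrib-- (λ w → δ w v * (+ outdeg A w * z w)) (λ w → + A w v * z w) ⟩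
  sumℤ (λ w → δ w v * (+ outdeg A w * z w)) - sumℤ (λ w → + A w v * z w)
    ≡⟨ cong (_- sumℤ (λ w → + A w v * z w)) (sumℤ-δ v (λ w → + outdeg A w * z w)) ⟩
  + outdeg A v * z v - sumℤ (λ w → + A w v * z w) ∎
  where
  distrib : ∀ a b c d → (a * b - c) * d ≡ a * (b * d) - c * d
  distrib = solve-∀

sumℤ-QT : ∀ {n} (A : Graph n) z → sumℤ (QT A z) ≡ + 0
sumℤ-QT A z = begin
  sumℤ (QT A z)
    ≡⟨ sumℤ-cong (QT-expand A z) ⟩
  sumℤ (λ v → + outdeg A v * z v - sumℤ (λ w → + A w v * z w))
    ≡⟨ sumℤ-distrib-- (λ v → + outdeg A v * z v) (λ v → sumℤ (λ w → + A w v * z w)) ⟩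
  sumℤ (λ v → + outdeg A v * z v) - sumℤ (λ v → sumℤ (λ w → + A w v * z w))
    ≡⟨ cong (_-_ (sumℤ (λ v → + outdeg A v * z v))) (sumℤ-comm (λ v w → + A w v * z w)) ⟩
  sumℤ (λ v → + outdeg A v * z v) - sumℤ (λ w → sumℤ (λ v → + A w v * z w))
    ≡⟨ cong (_-_ (sumℤ (λ v → + outdeg A v * z v))) (sumℤ-cong outflow) ⟩
  sumℤ (λ v → + outdeg A v * z v) - sumℤ (λ w → + outdeg A w * z w)
    ≡⟨ ℤP.+-inverseʳ (sumℤ (λ v → + outdeg A v * z v)) ⟩
  + 0 ∎
  where
  outflow : ∀ w → sumℤ (λ v → + A w v * z w) ≡ + outdeg A w * z w
  outflow w = trans (sym (*-distribʳ-sumℤ (z w) (λ v → + A w v)))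
                    (cong (_* z w) (sym (sumℕ-sumℤ (A w))))

QT-const : ∀ {n} (A : Graph n) → (∀ v → indeg A v ≡ outdeg A v) → ∀ c → QT A (λ _ → c) ≗ 0V
QT-const A balanced c v = begin
  QT A (λ _ → c) v
    ≡⟨ QT-expand A _ v ⟩
  + outdeg A v * c - sumℤ (λ w → + A w v * c)
    ≡⟨ cong (_-_ (+ outdeg A v * c)) (sym (*-distribʳ-sumℤ c (λ w → + A w v))) ⟩
  + outdeg A v * c - sumℤ (λ w → + A w v) * c
    ≡⟨ cong (λ d → + outdeg A v * c - d * c) (sym (sumℕ-sumℤ (λ w → A w v))) ⟩
  + outdeg A v * c - + indeg A v * c
    ≡⟨ cong (λ d → + outdeg A v * c - + d * c) (balanced v) ⟩
  + outdeg A v * c - + outdeg A v * c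
    ≡⟨ ℤP.+-inverseʳ (+ outdeg A v * c) ⟩
  + 0 ∎

≗⇒≈K : ∀ {n} (A : Graph n) {x y : ℤVec n} → x ≗ y → x ≈K[ A ] y
≗⇒≈K A {x} {y} x≗y = 0V , λ v → begin
  x v - y v ≡⟨ ℤP.i≡j⇒i-j≡0 (x≗y v) ⟩
  + 0       ≡⟨ sumℤ-zero (λ w → ℤP.*-zeroʳ (Lap A w v)) ⟨
  QT A 0V v ∎

incidence : ∀ {n k} → (Fin n → Fin k) → Fin n → Fin k → ℤ
incidence π i a = δ (π i) a

push : ∀ {n k} → (Fin n → Fin k) → ℤVec n → ℤVec k
push π = incidence π ᵀ·_

push-linear : ∀ {n k} (π : Fin n → Fin k) → IsLinear (push π)
push-linear π = ᵀ·-linear (incidence π)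

push-∘ : ∀ {l m n} (π : Fin m → Fin n) (σ : Fin l → Fin m) x → push π (push σ x) ≗ push (π ∘ σ) x
push-∘ π σ x a = begin
  sumℤ (λ i → δ (π i) a * sumℤ (λ b → δ (σ b) i * x b))
    ≡⟨ sumℤ-cong (λ i → *-distribˡ-sumℤ (δ (π i) a) (λ b → δ (σ b) i * x b)) ⟩
  sumℤ (λ i → sumℤ (λ b → δ (π i) a * (δ (σ b) i * x b)))
    ≡⟨ sumℤ-comm (λ i b → δ (π i) a * (δ (σ b) i * x b)) ⟩
  sumℤ (λ b → sumℤ (λ i → δ (π i) a * (δ (σ b) i * x b)))
    ≡⟨ sumℤ-cong (λ b → sumℤ-cong (λ i → reorder (δ (π i) a) (δ (σ b) i) (x b))) ⟩
  sumℤ (λ b → sumℤ (λ i → δ (σ b) i * (δ (π i) a * x b)))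
    ≡⟨ sumℤ-cong (λ b → sumℤ-δ′ (σ b) (λ i → δ (π i) a * x b)) ⟩
  sumℤ (λ b → δ (π (σ b)) a * x b) ∎
  where
  reorder : ∀ p q r → p * (q * r) ≡ q * (p * r)
  reorder = solve-∀

push-id : ∀ {n} {f : Fin n → Fin n} → (∀ b → f b ≡ b) → ∀ x → push f x ≗ x
push-id f≗id x a =
  trans (sumℤ-cong (λ b → cong (λ c → δ c a * x b) (f≗id b))) (sumℤ-δ a x)

push-sum : ∀ {n k} (π : Fin n → Fin k) f → sumℤ (push π f) ≡ sumℤ f
push-sum π f = begin
  sumℤ (λ a → sumℤ (λ i → δ (π i) a * f i))  ≡⟨ sumℤ-comm (λ a i → δ (π i) a * f i) ⟩
  sumℤ (λ i → sumℤ (λ a → δ (π i) a * f i))  ≡⟨ sumℤ-cong (λ i → sumℤ-δ′ (π i) (λ _ → f i)) ⟩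
  sumℤ f                                       ∎

push-projection : ∀ {n k} (π : Fin n → Fin k) f (z : ℤVec k) b →
                  push π f b * z b ≡ push π (λ y → f y * z (π y)) b
push-projection π f z b = begin
  sumℤ (λ y → δ (π y) b * f y) * z b
    ≡⟨ *-distribʳ-sumℤ (z b) (λ y → δ (π y) b * f y) ⟩
  sumℤ (λ y → δ (π y) b * f y * z b)
    ≡⟨ sumℤ-cong (λ y → trans (ℤP.*-assoc (δ (π y) b) (f y) (z b))
                              (sym (δ-*-subst (π y) b (λ c → f y * z c)))) ⟩
  sumℤ (λ y → δ (π y) b * (f y * z (π y))) ∎

-- The left-hand side is the summand in the definition of merge, which is
-- where-bound in Defs and so cannot be named here.
merge-summand : ∀ {n k} (A : Graph n) (π : Fin n → Fin k) a b x y →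
                _ ≡ δ (π x) a * (δ (π y) b * + A x y)

merge-push : ∀ {n k} (A : Graph n) (π : Fin n → Fin k) a b →
             + merge A π a b ≡ push π (λ x → push π (λ y → + A x y) b) a
merge-push {n} A π a b =
  trans (sumℕ-sumℤ {n} _) (sumℤ-cong λ x →
    trans (sumℕ-sumℤ {n} _)
          (trans (sumℤ-cong (merge-summand A π a b x))
                 (sym (*-distribˡ-sumℤ (δ (π x) a) (λ y → δ (π y) b * + A x y)))))

merge-summand A π a b x y with π x ≟ a | π y ≟ b
... | yes _ | yes _ = sym (trans (ℤP.*-identityˡ _) (ℤP.*-identityˡ _))
... | yes _ | no  _ = sym (ℤP.*-zeroʳ (+ 1))
... | no  _ | _     = refl

outdeg-merge : ∀ {n k} (A : Graph n) (π : Fin n → Fin k) a →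
               + outdeg (merge A π) a ≡ push π (λ x → + outdeg A x) a
outdeg-merge A π a = begin
  + outdeg (merge A π) a
    ≡⟨ sumℕ-sumℤ (merge A π a) ⟩
  sumℤ (λ b → + merge A π a b)
    ≡⟨ sumℤ-cong (merge-push A π a) ⟩
  sumℤ (λ b → push π (λ x → push π (λ y → + A x y) b) a)
    ≡⟨ ᵀ·-sumℤ (incidence π) (λ b x → push π (λ y → + A x y) b) a ⟩
  push π (λ x → sumℤ (push π (λ y → + A x y))) a
    ≡⟨ IsLinear.cong-≗ (push-linear π) (λ x → push-sum π (λ y → + A x y)) a ⟩
  push π (λ x → sumℤ (λ y → + A x y)) a
    ≡⟨ IsLinear.cong-≗ (push-linear π) (λ x → sumℕ-sumℤ (A x)) a ⟨
  push π (λ x → + outdeg A x) a ∎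

merge-inflow : ∀ {n k} (A : Graph n) (π : Fin n → Fin k) (z : ℤVec k) b →
               sumℤ (λ c → + merge A π c b * z c) ≡ push π (λ y → sumℤ (λ x → + A x y * z (π x))) b
merge-inflow A π z b = begin
  sumℤ (λ c → + merge A π c b * z c)
    ≡⟨ sumℤ-cong (λ c → cong (_* z c) (merge-push A π c b)) ⟩
  sumℤ (λ c → push π (λ x → push π (λ y → + A x y) b) c * z c)
    ≡⟨ sumℤ-cong (push-projection π (λ x → push π (λ y → + A x y) b) z) ⟩
  sumℤ (push π (λ x → push π (λ y → + A x y) b * z (π x)))
    ≡⟨ push-sum π _ ⟩
  sumℤ (λ x → push π (λ y → + A x y) b * z (π x))
    ≡⟨ sumℤ-cong (λ x → push-projection π (λ y → + A x y) (λ _ → z (π x)) b) ⟩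
  sumℤ (λ x → push π (λ y → + A x y * z (π x)) b)
    ≡⟨ ᵀ·-sumℤ (incidence π) (λ x y → + A x y * z (π x)) b ⟩
  push π (λ y → sumℤ (λ x → + A x y * z (π x))) b ∎

QT-merge : ∀ {n k} (A : Graph n) (π : Fin n → Fin k) z → QT (merge A π) z ≗ push π (QT A (z ∘ π))
QT-merge {n} A π z b = begin
  QT (merge A π) z b
    ≡⟨ QT-expand (merge A π) z b ⟩
  + outdeg (merge A π) b * z b - sumℤ (λ c → + merge A π c b * z c)
    ≡⟨ cong₂ _-_ (cong (_* z b) (outdeg-merge A π b)) (merge-inflow A π z b) ⟩
  push π (λ y → + outdeg A y) b * z b - push π inflow b
    ≡⟨ cong (_- push π inflow b) (push-projection π (λ y → + outdeg A y) z b) ⟩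
  push π (λ y → + outdeg A y * z (π y)) b - push π inflow b
    ≡⟨ P.-V-hom (λ y → + outdeg A y * z (π y)) inflow b ⟨
  push π (λ y → + outdeg A y * z (π y) - inflow y) b
    ≡⟨ P.cong-≗ (λ y → QT-expand A (z ∘ π) y) b ⟨
  push π (QT A (z ∘ π)) b ∎
  where
  module P = IsLinear (push-linear π)
  inflow : ℤVec n
  inflow y = sumℤ (λ x → + A x y * z (π x))

-- Isomorphisms of sandpile groups induced by automorphisms of ℤⁿ

record SplitEpi (n k : ℕ) : Set where
  field
    proj        : ℤVec n → ℤVec k
    lift        : ℤVec k → ℤVec n
    proj-linear : IsLinear proj
    lift-linear : IsLinear lift
    proj∘lift   : ∀ x → proj (lift x) ≗ x

open SplitEpi

pushSplitEpi : ∀ {n k} (π : Fin n → Fin k) → (∀ a → ∃ λ i → π i ≡ a) → SplitEpi n k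
pushSplitEpi {n} {k} π surjective = record
  { proj        = push π
  ; lift        = push section
  ; proj-linear = push-linear π
  ; lift-linear = push-linear section
  ; proj∘lift   = λ x a → trans (push-∘ π section x a) (push-id (proj₂ ∘ surjective) x a)
  }
  where
  section : Fin k → Fin n
  section a = proj₁ (surjective a)

MapsKernel : ∀ {n k k′} → SplitEpi n k → SplitEpi n k′ → (ℤVec n → ℤVec n) → Set
MapsKernel E E′ Φ = ∀ d → proj E d ≗ 0V → proj E′ (Φ d) ≗ 0V

MapsRelations : ∀ {n k k′} → Graph k → Graph k′ → SplitEpi n k → SplitEpi n k′ →
                (ℤVec n → ℤVec n) → Set
MapsRelations M M′ E E′ Φ =
  ∀ z → ∃ λ d → QT M z ≗ proj E d × ∃ λ z′ → proj E′ (Φ d) ≗ QT M′ z′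

descend : ∀ {n k k′} → SplitEpi n k → SplitEpi n k′ → (ℤVec n → ℤVec n) → ℤVec k → ℤVec k′
descend E E′ Φ = proj E′ ∘ Φ ∘ lift E

module Descent {n k k′ : ℕ} (E : SplitEpi n k) (E′ : SplitEpi n k′) {Φ : ℤVec n → ℤVec n}
                (Φ-linear : IsLinear Φ) (Φ-ker : MapsKernel E E′ Φ) where

  descend-linear : IsLinear (descend E E′ Φ)
  descend-linear = ∘-linear (proj-linear E′) (∘-linear Φ-linear (lift-linear E))

  proj-Φ-respects : ∀ {d e} → proj E d ≗ proj E e → proj E′ (Φ d) ≗ proj E′ (Φ e)
  proj-Φ-respects {d} {e} pd≗pe v = ℤP.i-j≡0⇒i≡j _ _ (begin
    proj E′ (Φ d) v - proj E′ (Φ e) v ≡⟨ IsLinear.-V-hom p′Φ-linear d e v ⟨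
    proj E′ (Φ (d -V e)) v            ≡⟨ Φ-ker (d -V e) p[d-e]≗0 v ⟩
    + 0                               ∎)
    where
    p′Φ-linear : IsLinear (proj E′ ∘ Φ)
    p′Φ-linear = ∘-linear (proj-linear E′) Φ-linear
    p[d-e]≗0 : proj E (d -V e) ≗ 0V
    p[d-e]≗0 a = trans (IsLinear.-V-hom (proj-linear E) d e a) (ℤP.i≡j⇒i-j≡0 (pd≗pe a))

  descend-proj : ∀ d → descend E E′ Φ (proj E d) ≗ proj E′ (Φ d)
  descend-proj d = proj-Φ-respects (proj∘lift E (proj E d))

  descend-isKHom : ∀ {M M′} → MapsRelations M M′ E E′ Φ → IsKHom M M′ (descend E E′ Φ)
  descend-isKHom {M} {M′} rel = F.+-hom , respects
    where
    module F = IsLinear descend-linear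
    respects : ∀ x y → x ≈K[ M ] y → descend E E′ Φ x ≈K[ M′ ] descend E E′ Φ y
    respects x y (z , x-y≡Qz) with rel z
    ... | d , Qz≗pd , z′ , p′Φd≗Q′z′ = z′ , λ v → begin
      descend E E′ Φ x v - descend E E′ Φ y v ≡⟨ F.-V-hom x y v ⟨
      descend E E′ Φ (x -V y) v              ≡⟨ F.cong-≗ (λ w → trans (x-y≡Qz w) (Qz≗pd w)) v ⟩
      descend E E′ Φ (proj E d) v            ≡⟨ descend-proj d v ⟩
      proj E′ (Φ d) v                        ≡⟨ p′Φd≗Q′z′ v ⟩
      QT M′ z′ v                             ∎

descend-inverse : ∀ {n k k′} (E : SplitEpi n k) (E′ : SplitEpi n k′) {Φ Ψ : ℤVec n → ℤVec n} →
                  IsLinear Ψ → MapsKernel E′ E Ψ → (∀ d → Ψ (Φ d) ≗ d) →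
                  ∀ x → descend E′ E Ψ (descend E E′ Φ x) ≗ x
descend-inverse E E′ {Φ} {Ψ} Ψ-linear Ψ-ker Ψ∘Φ≗id x a = begin
  descend E′ E Ψ (proj E′ (Φ (lift E x))) a ≡⟨ Descent.descend-proj E′ E Ψ-linear Ψ-ker _ a ⟩
  proj E (Ψ (Φ (lift E x))) a               ≡⟨ IsLinear.cong-≗ (proj-linear E) (Ψ∘Φ≗id (lift E x)) a ⟩
  proj E (lift E x) a                       ≡⟨ proj∘lift E x a ⟩
  x a                                       ∎

≅K-via-automorphism :
  ∀ {n k k′} {M : Graph k} {M′ : Graph k′} (E : SplitEpi n k) (E′ : SplitEpi n k′)
    {Φ Ψ : ℤVec n → ℤVec n} → IsLinear Φ → IsLinear Ψ →
    (∀ d → Ψ (Φ d) ≗ d) → (∀ d → Φ (Ψ d) ≗ d) →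
    MapsKernel E E′ Φ → MapsKernel E′ E Ψ →
    MapsRelations M M′ E E′ Φ → MapsRelations M′ M E′ E Ψ →
    M ≅K M′
≅K-via-automorphism {M = M} {M′} E E′ {Φ} {Ψ} Φ-linear Ψ-linear Ψ∘Φ≗id Φ∘Ψ≗id Φ-ker Ψ-ker Φ-rel Ψ-rel =
  descend E E′ Φ , descend E′ E Ψ ,
  Descent.descend-isKHom E E′ Φ-linear Φ-ker Φ-rel ,
  Descent.descend-isKHom E′ E Ψ-linear Ψ-ker Ψ-rel ,
  (λ x → ≗⇒≈K M (descend-inverse E E′ Ψ-linear Ψ-ker Ψ∘Φ≗id x)) ,
  (λ y → ≗⇒≈K M′ (descend-inverse E′ E Φ-linear Φ-ker Φ∘Ψ≗id y))

-- Pushforward along an identification of two pairs of vertices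

push-fibre₁ : ∀ {n k} {π : Fin n → Fin k} {i} → (∀ x → π x ≡ π i → x ≡ i) →
              ∀ f → push π f (π i) ≡ f i
push-fibre₁ {π = π} {i} fibre f =
  trans (sumℤ-single i (λ x x≢i → δ-*-≢ (x≢i ∘ fibre x) (f x))) (δ-*-≡ {a = π i} refl (f i))

push-fibre₂ : ∀ {n k} {π : Fin n → Fin k} {p q} → p ≢ q → π q ≡ π p →
              (∀ x → π x ≡ π p → x ≡ p ⊎ x ≡ q) → ∀ f → push π f (π p) ≡ f p + f q
push-fibre₂ {π = π} {p} {q} p≢q πq≡πp fibre f =
  trans (sumℤ-pair p≢q outside) (cong₂ _+_ (δ-*-≡ {a = π p} refl (f p)) (δ-*-≡ πq≡πp (f q)))
  where
  outside : ∀ x → x ≢ p → x ≢ q → δ (π x) (π p) * f x ≡ + 0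
  outside x x≢p x≢q = δ-*-≢ (λ e → [ x≢p , x≢q ]′ (fibre x e)) (f x)

record GlueKernel {n} (p₁ q₁ p₂ q₂ : Fin n) (d : ℤVec n) : Set where
  field
    outside : ∀ i → i ≢ p₁ → i ≢ q₁ → i ≢ p₂ → i ≢ q₂ → d i ≡ + 0
    pair₁   : d p₁ + d q₁ ≡ + 0
    pair₂   : d p₂ + d q₂ ≡ + 0

module Identification {n k : ℕ} {p₁ q₁ p₂ q₂ : Fin n}
  (p₁≢q₁ : p₁ ≢ q₁) (p₂≢q₂ : p₂ ≢ q₂) (p₁≢p₂ : p₁ ≢ p₂) (p₁≢q₂ : p₁ ≢ q₂) (p₂≢q₁ : p₂ ≢ q₁)
  {π : Fin n → Fin k} (identification : IsIdentification p₁ q₁ p₂ q₂ π) where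

  glued : ∀ {x y} → Glue p₁ q₁ p₂ q₂ x y → π x ≡ π y
  glued = Equivalence.from (proj₂ identification _ _)

  unglued : ∀ {x y} → π x ≡ π y → Glue p₁ q₁ p₂ q₂ x y
  unglued = Equivalence.to (proj₂ identification _ _)

  fibre-outside : ∀ {i} → i ≢ p₁ → i ≢ q₁ → i ≢ p₂ → i ≢ q₂ → ∀ x → π x ≡ π i → x ≡ i
  fibre-outside i≢p₁ i≢q₁ i≢p₂ i≢q₂ x πx≡πi with unglued πx≡πi
  ... | inj₁ x≡i                                  = x≡i
  ... | inj₂ (inj₁ (_ , i≡q₁))                    = ⊥-elim (i≢q₁ i≡q₁)
  ... | inj₂ (inj₂ (inj₁ (_ , i≡p₁)))             = ⊥-elim (i≢p₁ i≡p₁)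
  ... | inj₂ (inj₂ (inj₂ (inj₁ (_ , i≡q₂))))      = ⊥-elim (i≢q₂ i≡q₂)
  ... | inj₂ (inj₂ (inj₂ (inj₂ (_ , i≡p₂))))      = ⊥-elim (i≢p₂ i≡p₂)

  fibre-p₁ : ∀ x → π x ≡ π p₁ → x ≡ p₁ ⊎ x ≡ q₁
  fibre-p₁ x πx≡πp₁ with unglued πx≡πp₁
  ... | inj₁ x≡p₁                                 = inj₁ x≡p₁
  ... | inj₂ (inj₁ (x≡p₁ , _))                    = inj₁ x≡p₁
  ... | inj₂ (inj₂ (inj₁ (x≡q₁ , _)))             = inj₂ x≡q₁
  ... | inj₂ (inj₂ (inj₂ (inj₁ (_ , p₁≡q₂))))     = ⊥-elim (p₁≢q₂ p₁≡q₂)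
  ... | inj₂ (inj₂ (inj₂ (inj₂ (_ , p₁≡p₂))))     = ⊥-elim (p₁≢p₂ p₁≡p₂)

  fibre-p₂ : ∀ x → π x ≡ π p₂ → x ≡ p₂ ⊎ x ≡ q₂
  fibre-p₂ x πx≡πp₂ with unglued πx≡πp₂
  ... | inj₁ x≡p₂                                 = inj₁ x≡p₂
  ... | inj₂ (inj₁ (_ , p₂≡q₁))                   = ⊥-elim (p₂≢q₁ p₂≡q₁)
  ... | inj₂ (inj₂ (inj₁ (_ , p₂≡p₁)))            = ⊥-elim (p₁≢p₂ (sym p₂≡p₁))
  ... | inj₂ (inj₂ (inj₂ (inj₁ (x≡p₂ , _))))      = inj₁ x≡p₂
  ... | inj₂ (inj₂ (inj₂ (inj₂ (x≡q₂ , _))))      = inj₂ x≡q₂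

  push-p₁ : ∀ f → push π f (π p₁) ≡ f p₁ + f q₁
  push-p₁ = push-fibre₂ p₁≢q₁ (glued (inj₂ (inj₂ (inj₁ (refl , refl))))) fibre-p₁

  push-p₂ : ∀ f → push π f (π p₂) ≡ f p₂ + f q₂
  push-p₂ = push-fibre₂ p₂≢q₂ (glued (inj₂ (inj₂ (inj₂ (inj₂ (refl , refl)))))) fibre-p₂

  push≗0⇒kernel : ∀ {d} → push π d ≗ 0V → GlueKernel p₁ q₁ p₂ q₂ d
  push≗0⇒kernel {d} πd≗0 = record
    { outside = λ i i≢p₁ i≢q₁ i≢p₂ i≢q₂ →
        trans (sym (push-fibre₁ (fibre-outside i≢p₁ i≢q₁ i≢p₂ i≢q₂) d)) (πd≗0 (π i))
    ; pair₁   = trans (sym (push-p₁ d)) (πd≗0 (π p₁))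
    ; pair₂   = trans (sym (push-p₂ d)) (πd≗0 (π p₂))
    }

  kernel⇒push≗0 : ∀ {d} → GlueKernel p₁ q₁ p₂ q₂ d → push π d ≗ 0V
  kernel⇒push≗0 {d} d∈ker b with proj₁ identification b
  ... | x , refl = vanishes x
    where
    open GlueKernel d∈ker
    vanishes : ∀ x → push π d (π x) ≡ + 0
    vanishes x with x ≟ p₁ | x ≟ q₁ | x ≟ p₂ | x ≟ q₂
    ... | yes refl | _        | _        | _        = trans (push-p₁ d) pair₁
    ... | no _     | yes refl | _        | _        =
      trans (cong (push π d) (glued (inj₂ (inj₂ (inj₁ (refl , refl)))))) (trans (push-p₁ d) pair₁)
    ... | no _     | no _     | yes refl | _        = trans (push-p₂ d) pair₂
    ... | no _     | no _     | no _     | yes refl =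
      trans (cong (push π d) (glued (inj₂ (inj₂ (inj₂ (inj₂ (refl , refl))))))) (trans (push-p₂ d) pair₂)
    ... | no x≢p₁  | no x≢q₁  | no x≢p₂  | no x≢q₂  =
      trans (push-fibre₁ (fibre-outside x≢p₁ x≢q₁ x≢p₂ x≢q₂) d) (outside x x≢p₁ x≢q₁ x≢p₂ x≢q₂)

-- The disjoint union G ⊕ H and the reflection of H

↑ˡ≢↑ʳ : ∀ {m n} (a : Fin m) (j : Fin n) → a ↑ˡ n ≢ m ↑ʳ j
↑ˡ≢↑ʳ {m} {n} a j eq
  with () ← trans (sym (splitAt-↑ˡ m a n)) (trans (cong (splitAt m) eq) (splitAt-↑ʳ m n j))

↑-elim : ∀ {m n} (P : Fin (m ℕ.+ n) → Set) → (∀ a → P (a ↑ˡ n)) → (∀ j → P (m ↑ʳ j)) → ∀ i → P i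
↑-elim {m} P left right i with splitAt m i in eq
... | inj₁ a = subst P (splitAt⁻¹-↑ˡ eq) (left a)
... | inj₂ j = subst P (splitAt⁻¹-↑ʳ eq) (right j)

sumℤ-++ˡ : ∀ m {n} {f : Fin (m ℕ.+ n) → ℤ} → (∀ j → f (m ↑ʳ j) ≡ + 0) →
           sumℤ f ≡ sumℤ (λ a → f (a ↑ˡ n))
sumℤ-++ˡ m {n} {f} right≡0 =
  trans (sumℤ-++ m f) (trans (cong (_+_ (sumℤ (λ a → f (a ↑ˡ n)))) (sumℤ-zero right≡0)) (ℤP.+-identityʳ _))

sumℤ-++ʳ : ∀ m {n} {f : Fin (m ℕ.+ n) → ℤ} → (∀ a → f (a ↑ˡ n) ≡ + 0) →
           sumℤ f ≡ sumℤ (λ j → f (m ↑ʳ j))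
sumℤ-++ʳ m {n} {f} left≡0 =
  trans (sumℤ-++ m f) (trans (cong (_+ sumℤ (λ j → f (m ↑ʳ j))) (sumℤ-zero left≡0)) (ℤP.+-identityˡ _))

module _ {m n : ℕ} (G : Graph m) (H : Graph n) where

  ⊕-ˡˡ : ∀ a b → (G ⊕ H) (a ↑ˡ n) (b ↑ˡ n) ≡ G a b
  ⊕-ˡˡ a b rewrite splitAt-↑ˡ m a n | splitAt-↑ˡ m b n = refl

  ⊕-ˡʳ : ∀ a j → (G ⊕ H) (a ↑ˡ n) (m ↑ʳ j) ≡ 0
  ⊕-ˡʳ a j rewrite splitAt-↑ˡ m a n | splitAt-↑ʳ m n j = refl

  ⊕-ʳˡ : ∀ j a → (G ⊕ H) (m ↑ʳ j) (a ↑ˡ n) ≡ 0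
  ⊕-ʳˡ j a rewrite splitAt-↑ʳ m n j | splitAt-↑ˡ m a n = refl

  ⊕-ʳʳ : ∀ i j → (G ⊕ H) (m ↑ʳ i) (m ↑ʳ j) ≡ H i j
  ⊕-ʳʳ i j rewrite splitAt-↑ʳ m n i | splitAt-↑ʳ m n j = refl

  QT-⊕ˡ : ∀ u a → QT (G ⊕ H) u (a ↑ˡ n) ≡ QT G (λ b → u (b ↑ˡ n)) a
  QT-⊕ˡ u a = begin
    QT (G ⊕ H) u (a ↑ˡ n)
      ≡⟨ QT-expand (G ⊕ H) u (a ↑ˡ n) ⟩
    + outdeg (G ⊕ H) (a ↑ˡ n) * u (a ↑ˡ n) - sumℤ (λ x → + (G ⊕ H) x (a ↑ˡ n) * u x)
      ≡⟨ cong₂ (λ s t → s * u (a ↑ˡ n) - t) outdeg≡ inflow≡ ⟩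
    + outdeg G a * u (a ↑ˡ n) - sumℤ (λ b → + G b a * u (b ↑ˡ n))
      ≡⟨ QT-expand G (λ b → u (b ↑ˡ n)) a ⟨
    QT G (λ b → u (b ↑ˡ n)) a ∎
    where
    outdeg≡ : + outdeg (G ⊕ H) (a ↑ˡ n) ≡ + outdeg G a
    outdeg≡ = begin
      + outdeg (G ⊕ H) (a ↑ˡ n)                ≡⟨ sumℕ-sumℤ ((G ⊕ H) (a ↑ˡ n)) ⟩
      sumℤ (λ x → + (G ⊕ H) (a ↑ˡ n) x)        ≡⟨ sumℤ-++ˡ m (λ j → cong +_ (⊕-ˡʳ a j)) ⟩
      sumℤ (λ b → + (G ⊕ H) (a ↑ˡ n) (b ↑ˡ n)) ≡⟨ sumℤ-cong (λ b → cong +_ (⊕-ˡˡ a b)) ⟩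
      sumℤ (λ b → + G a b)                     ≡⟨ sumℕ-sumℤ (G a) ⟨
      + outdeg G a                             ∎
    inflow≡ : sumℤ (λ x → + (G ⊕ H) x (a ↑ˡ n) * u x) ≡ sumℤ (λ b → + G b a * u (b ↑ˡ n))
    inflow≡ = trans (sumℤ-++ˡ m (λ j → cong (λ e → + e * u (m ↑ʳ j)) (⊕-ʳˡ j a)))
                    (sumℤ-cong (λ b → cong (λ e → + e * u (b ↑ˡ n)) (⊕-ˡˡ b a)))

  QT-⊕ʳ : ∀ u j → QT (G ⊕ H) u (m ↑ʳ j) ≡ QT H (λ i → u (m ↑ʳ i)) j
  QT-⊕ʳ u j = begin
    QT (G ⊕ H) u (m ↑ʳ j)
      ≡⟨ QT-expand (G ⊕ H) u (m ↑ʳ j) ⟩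
    + outdeg (G ⊕ H) (m ↑ʳ j) * u (m ↑ʳ j) - sumℤ (λ x → + (G ⊕ H) x (m ↑ʳ j) * u x)
      ≡⟨ cong₂ (λ s t → s * u (m ↑ʳ j) - t) outdeg≡ inflow≡ ⟩
    + outdeg H j * u (m ↑ʳ j) - sumℤ (λ i → + H i j * u (m ↑ʳ i))
      ≡⟨ QT-expand H (λ i → u (m ↑ʳ i)) j ⟨
    QT H (λ i → u (m ↑ʳ i)) j ∎
    where
    outdeg≡ : + outdeg (G ⊕ H) (m ↑ʳ j) ≡ + outdeg H j
    outdeg≡ = begin
      + outdeg (G ⊕ H) (m ↑ʳ j)                ≡⟨ sumℕ-sumℤ ((G ⊕ H) (m ↑ʳ j)) ⟩
      sumℤ (λ x → + (G ⊕ H) (m ↑ʳ j) x)        ≡⟨ sumℤ-++ʳ m (λ a → cong +_ (⊕-ʳˡ j a)) ⟩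
      sumℤ (λ i → + (G ⊕ H) (m ↑ʳ j) (m ↑ʳ i)) ≡⟨ sumℤ-cong (λ i → cong +_ (⊕-ʳʳ j i)) ⟩
      sumℤ (λ i → + H j i)                     ≡⟨ sumℕ-sumℤ (H j) ⟨
      + outdeg H j                             ∎
    inflow≡ : sumℤ (λ x → + (G ⊕ H) x (m ↑ʳ j) * u x) ≡ sumℤ (λ i → + H i j * u (m ↑ʳ i))
    inflow≡ = trans (sumℤ-++ʳ m (λ a → cong (λ e → + e * u (a ↑ˡ n)) (⊕-ˡʳ a j)))
                    (sumℤ-cong (λ i → cong (λ e → + e * u (m ↑ʳ i)) (⊕-ʳʳ i j)))

sumʳ : ∀ m {n} → ℤVec (m ℕ.+ n) → ℤ
sumʳ m d = sumℤ (λ j → d (m ↑ʳ j))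

reflectDiv : ∀ {m n} → Fin m → Fin m → ℤVec (m ℕ.+ n) → ℤVec (m ℕ.+ n)
reflectDiv {m} {n} v₁ v₂ d =
  (λ a → d (a ↑ˡ n) + (δ a v₁ + δ a v₂) * sumʳ m d) ++ (λ j → - d (m ↑ʳ j))

reflectPot : ∀ m {n} → ℤ → ℤVec (m ℕ.+ n) → ℤVec (m ℕ.+ n)
reflectPot m {n} c u = (λ a → u (a ↑ˡ n)) ++ (λ j → c - u (m ↑ʳ j))

module _ {m n : ℕ} (v₁ v₂ : Fin m) where

  private
    weight : Fin m → ℤ
    weight a = δ a v₁ + δ a v₂

  reflectDiv-ˡ : ∀ d a → reflectDiv v₁ v₂ d (a ↑ˡ n) ≡ d (a ↑ˡ n) + weight a * sumʳ m d
  reflectDiv-ˡ d = lookup-++ˡ _ _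

  reflectDiv-ʳ : ∀ d j → reflectDiv {n = n} v₁ v₂ d (m ↑ʳ j) ≡ - d (m ↑ʳ j)
  reflectDiv-ʳ d = lookup-++ʳ {m = m} _ _

  reflectDiv-linear : IsLinear (reflectDiv {n = n} v₁ v₂)
  reflectDiv-linear = record { cong-≗ = cong-≗ ; +-hom = +-hom }
    where
    cong-≗ : ∀ {d e} → d ≗ e → reflectDiv v₁ v₂ d ≗ reflectDiv v₁ v₂ e
    cong-≗ {d} {e} d≗e = ↑-elim _
      (λ a → trans (reflectDiv-ˡ d a)
               (trans (cong₂ (λ s t → s + weight a * t) (d≗e (a ↑ˡ n)) (sumℤ-cong (d≗e ∘ (m ↑ʳ_))))
                      (sym (reflectDiv-ˡ e a))))
      (λ j → trans (reflectDiv-ʳ d j) (trans (cong -_ (d≗e (m ↑ʳ j))) (sym (reflectDiv-ʳ e j))))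
    +-hom : ∀ d e → reflectDiv v₁ v₂ (d +V e) ≗ reflectDiv v₁ v₂ d +V reflectDiv v₁ v₂ e
    +-hom d e = ↑-elim _
      (λ a → trans (reflectDiv-ˡ (d +V e) a)
               (trans (cong (λ t → d (a ↑ˡ n) + e (a ↑ˡ n) + weight a * t)
                            (sumℤ-distrib-+ (d ∘ (m ↑ʳ_)) (e ∘ (m ↑ʳ_))))
                      (trans (regroup (d (a ↑ˡ n)) (e (a ↑ˡ n)) (weight a) (sumʳ m d) (sumʳ m e))
                             (sym (cong₂ _+_ (reflectDiv-ˡ d a) (reflectDiv-ˡ e a))))))
      (λ j → trans (reflectDiv-ʳ (d +V e) j)
               (trans (ℤP.neg-distrib-+ (d (m ↑ʳ j)) (e (m ↑ʳ j)))
                      (sym (cong₂ _+_ (reflectDiv-ʳ d j) (reflectDiv-ʳ e j)))))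
      where
      regroup : ∀ x y c s t → x + y + c * (s + t) ≡ (x + c * s) + (y + c * t)
      regroup = solve-∀

  sumʳ-reflectDiv : ∀ d → sumʳ m (reflectDiv {n = n} v₁ v₂ d) ≡ - sumʳ m d
  sumʳ-reflectDiv d = trans (sumℤ-cong (reflectDiv-ʳ d)) (sumℤ-neg (d ∘ (m ↑ʳ_)))

  reflectDiv-involutive : ∀ d → reflectDiv v₁ v₂ (reflectDiv v₁ v₂ d) ≗ d
  reflectDiv-involutive d = ↑-elim _
    (λ a → trans (reflectDiv-ˡ (reflectDiv v₁ v₂ d) a)
             (trans (cong₂ (λ s t → s + weight a * t) (reflectDiv-ˡ d a) (sumʳ-reflectDiv d))
                    (cancel (d (a ↑ˡ n)) (weight a) (sumʳ m d))))
    (λ j → trans (reflectDiv-ʳ (reflectDiv v₁ v₂ d) j)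
             (trans (cong -_ (reflectDiv-ʳ d j)) (ℤP.neg-involutive (d (m ↑ʳ j)))))
    where
    cancel : ∀ x c s → x + c * s + c * - s ≡ x
    cancel = solve-∀

  reflectPot-ˡ : ∀ c u a → reflectPot m {n} c u (a ↑ˡ n) ≡ u (a ↑ˡ n)
  reflectPot-ˡ c u = lookup-++ˡ {m = m} _ _

  reflectPot-ʳ : ∀ c u j → reflectPot m {n} c u (m ↑ʳ j) ≡ c - u (m ↑ʳ j)
  reflectPot-ʳ c u = lookup-++ʳ {m = m} _ _

  module _ {w₁ w₂ : Fin n} where

    private
      a+b-b : ∀ a b → a + b - b ≡ a
      a+b-b = solve-∀
      a+b-a : ∀ a b → a + b - a ≡ b
      a+b-a = solve-∀
      P₁ P₂ Q₁ Q₂ : Fin (m ℕ.+ n)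
      P₁ = v₁ ↑ˡ n
      P₂ = v₂ ↑ˡ n
      Q₁ = m ↑ʳ w₁
      Q₂ = m ↑ʳ w₂

    reflectDiv-kernel : v₁ ≢ v₂ → w₁ ≢ w₂ → ∀ {d} → GlueKernel P₁ Q₁ P₂ Q₂ d →
                        GlueKernel P₁ Q₂ P₂ Q₁ (reflectDiv v₁ v₂ d)
    reflectDiv-kernel v₁≢v₂ w₁≢w₂ {d} d∈ker = record
      { outside = ↑-elim _ outsideˡ outsideʳ
      ; pair₁   = begin
          reflectDiv v₁ v₂ d P₁ + reflectDiv v₁ v₂ d Q₂
            ≡⟨ cong₂ _+_ (reflectDiv-ˡ d v₁) (reflectDiv-ʳ d w₂) ⟩
          d P₁ + (δ v₁ v₁ + δ v₁ v₂) * sumʳ m d + - d Q₂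
            ≡⟨ cong₂ (λ c s → d P₁ + c * s + - d Q₂) (cong₂ _+_ (δ-≡ {a = v₁} refl) (δ-≢ v₁≢v₂)) sumʳ≡ ⟩
          d P₁ + (+ 1 + + 0) * (d Q₁ + d Q₂) + - d Q₂
            ≡⟨ simplify₁ (d P₁) (d Q₁) (d Q₂) ⟩
          d P₁ + d Q₁
            ≡⟨ pair₁ ⟩
          + 0 ∎
      ; pair₂   = begin
          reflectDiv v₁ v₂ d P₂ + reflectDiv v₁ v₂ d Q₁
            ≡⟨ cong₂ _+_ (reflectDiv-ˡ d v₂) (reflectDiv-ʳ d w₁) ⟩
          d P₂ + (δ v₂ v₁ + δ v₂ v₂) * sumʳ m d + - d Q₁
            ≡⟨ cong₂ (λ c s → d P₂ + c * s + - d Q₁) (cong₂ _+_ (δ-≢ (v₁≢v₂ ∘ sym)) (δ-≡ {a = v₂} refl)) sumʳ≡ ⟩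
          d P₂ + (+ 0 + + 1) * (d Q₁ + d Q₂) + - d Q₁
            ≡⟨ simplify₂ (d P₂) (d Q₁) (d Q₂) ⟩
          d P₂ + d Q₂
            ≡⟨ pair₂ ⟩
          + 0 ∎
      }
      where
      open GlueKernel d∈ker
      sumʳ≡ : sumʳ m d ≡ d Q₁ + d Q₂
      sumʳ≡ = sumℤ-pair w₁≢w₂ λ j j≢w₁ j≢w₂ →
        outside (m ↑ʳ j) (↑ˡ≢↑ʳ v₁ j ∘ sym) (j≢w₁ ∘ ↑ʳ-injective m _ _)
                         (↑ˡ≢↑ʳ v₂ j ∘ sym) (j≢w₂ ∘ ↑ʳ-injective m _ _)
      outsideˡ : ∀ a → a ↑ˡ n ≢ P₁ → a ↑ˡ n ≢ Q₂ → a ↑ˡ n ≢ P₂ → a ↑ˡ n ≢ Q₁ →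
                 reflectDiv v₁ v₂ d (a ↑ˡ n) ≡ + 0
      outsideˡ a a≢v₁ _ a≢v₂ _ = begin
        reflectDiv v₁ v₂ d (a ↑ˡ n)                   ≡⟨ reflectDiv-ˡ d a ⟩
        d (a ↑ˡ n) + (δ a v₁ + δ a v₂) * sumʳ m d     ≡⟨ cong₂ (λ x c → x + c * sumʳ m d) d[a]≡0
                                                          (cong₂ _+_ (δ-≢ (a≢v₁ ∘ cong (_↑ˡ n)))
                                                                     (δ-≢ (a≢v₂ ∘ cong (_↑ˡ n)))) ⟩
        + 0 + (+ 0 + + 0) * sumʳ m d                  ≡⟨ ℤP.*-zeroˡ (sumʳ m d) ⟩
        + 0                                           ∎
        where
        d[a]≡0 : d (a ↑ˡ n) ≡ + 0
        d[a]≡0 = outside (a ↑ˡ n) a≢v₁ (↑ˡ≢↑ʳ a w₁) a≢v₂ (↑ˡ≢↑ʳ a w₂)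
      outsideʳ : ∀ j → m ↑ʳ j ≢ P₁ → m ↑ʳ j ≢ Q₂ → m ↑ʳ j ≢ P₂ → m ↑ʳ j ≢ Q₁ →
                 reflectDiv v₁ v₂ d (m ↑ʳ j) ≡ + 0
      outsideʳ j j≢v₁ j≢w₂ j≢v₂ j≢w₁ =
        trans (reflectDiv-ʳ d j) (cong -_ (outside (m ↑ʳ j) j≢v₁ j≢w₁ j≢v₂ j≢w₂))
      simplify₁ : ∀ p q₁ q₂ → p + (+ 1 + + 0) * (q₁ + q₂) + - q₂ ≡ p + q₁
      simplify₁ = solve-∀
      simplify₂ : ∀ p q₁ q₂ → p + (+ 0 + + 1) * (q₁ + q₂) + - q₁ ≡ p + q₂
      simplify₂ = solve-∀

    reflectPot-glue : ∀ u → u P₁ ≡ u Q₁ → u P₂ ≡ u Q₂ → ∀ {x y} → Glue P₁ Q₂ P₂ Q₁ x y →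
                      reflectPot m (u Q₁ + u Q₂) u x ≡ reflectPot m (u Q₁ + u Q₂) u y
    reflectPot-glue u u₁ u₂ (inj₁ refl)                               = refl
    reflectPot-glue u u₁ u₂ (inj₂ (inj₁ (refl , refl)))               = P₁~Q₂
      where
      P₁~Q₂ : reflectPot m (u Q₁ + u Q₂) u P₁ ≡ reflectPot m (u Q₁ + u Q₂) u Q₂
      P₁~Q₂ = trans (reflectPot-ˡ (u Q₁ + u Q₂) u v₁) (trans u₁ (sym (trans (reflectPot-ʳ (u Q₁ + u Q₂) u w₂) (a+b-b (u Q₁) (u Q₂)))))
    reflectPot-glue u u₁ u₂ (inj₂ (inj₂ (inj₁ (refl , refl))))        =
      sym (reflectPot-glue u u₁ u₂ (inj₂ (inj₁ (refl , refl))))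
    reflectPot-glue u u₁ u₂ (inj₂ (inj₂ (inj₂ (inj₁ (refl , refl))))) = P₂~Q₁
      where
      P₂~Q₁ : reflectPot m (u Q₁ + u Q₂) u P₂ ≡ reflectPot m (u Q₁ + u Q₂) u Q₁
      P₂~Q₁ = trans (reflectPot-ˡ (u Q₁ + u Q₂) u v₂) (trans u₂ (sym (trans (reflectPot-ʳ (u Q₁ + u Q₂) u w₁) (a+b-a (u Q₁) (u Q₂)))))
    reflectPot-glue u u₁ u₂ (inj₂ (inj₂ (inj₂ (inj₂ (refl , refl))))) =
      sym (reflectPot-glue u u₁ u₂ (inj₂ (inj₂ (inj₂ (inj₁ (refl , refl))))))

  reflectDiv-QT : {G : Graph m} {H : Graph n} → (∀ j → indeg H j ≡ outdeg H j) →
                  ∀ c u → reflectDiv v₁ v₂ (QT (G ⊕ H) u) ≗ QT (G ⊕ H) (reflectPot m c u)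
  reflectDiv-QT {G} {H} H-balanced c u = ↑-elim _
    (λ a → begin
      reflectDiv v₁ v₂ (QT (G ⊕ H) u) (a ↑ˡ n)
        ≡⟨ reflectDiv-ˡ (QT (G ⊕ H) u) a ⟩
      QT (G ⊕ H) u (a ↑ˡ n) + weight a * sumʳ m (QT (G ⊕ H) u)
        ≡⟨ cong₂ (λ x s → x + weight a * s) (QT-⊕ˡ G H u a) sumʳ-QT ⟩
      QT G (u ∘ (_↑ˡ n)) a + weight a * + 0
        ≡⟨ trans (cong (_+_ (QT G (u ∘ (_↑ˡ n)) a)) (ℤP.*-zeroʳ (weight a))) (ℤP.+-identityʳ _) ⟩
      QT G (u ∘ (_↑ˡ n)) a
        ≡⟨ IsLinear.cong-≗ (QT-linear G) (λ b → sym (reflectPot-ˡ c u b)) a ⟩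
      QT G (reflectPot m c u ∘ (_↑ˡ n)) a
        ≡⟨ QT-⊕ˡ G H (reflectPot m c u) a ⟨
      QT (G ⊕ H) (reflectPot m c u) (a ↑ˡ n) ∎)
    (λ j → begin
      reflectDiv v₁ v₂ (QT (G ⊕ H) u) (m ↑ʳ j)
        ≡⟨ reflectDiv-ʳ (QT (G ⊕ H) u) j ⟩
      - QT (G ⊕ H) u (m ↑ʳ j)
        ≡⟨ cong -_ (QT-⊕ʳ G H u j) ⟩
      - QT H uʳ j
        ≡⟨ ℤP.+-identityˡ (- QT H uʳ j) ⟨
      + 0 - QT H uʳ j
        ≡⟨ cong (_- QT H uʳ j) (QT-const H H-balanced c j) ⟨
      QT H (λ _ → c) j - QT H uʳ j
        ≡⟨ IsLinear.-V-hom (QT-linear H) (λ _ → c) uʳ j ⟨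
      QT H (λ i → c - uʳ i) j
        ≡⟨ IsLinear.cong-≗ (QT-linear H) (λ i → sym (reflectPot-ʳ c u i)) j ⟩
      QT H (reflectPot m c u ∘ (m ↑ʳ_)) j
        ≡⟨ QT-⊕ʳ G H (reflectPot m c u) j ⟨
      QT (G ⊕ H) (reflectPot m c u) (m ↑ʳ j) ∎)
    where
    uʳ : ℤVec n
    uʳ i = u (m ↑ʳ i)
    sumʳ-QT : sumʳ m (QT (G ⊕ H) u) ≡ + 0
    sumʳ-QT = trans (sumℤ-cong (QT-⊕ʳ G H u)) (sumℤ-QT H uʳ)

factor-through : ∀ {n k} {A : Set} {π : Fin n → Fin k} (surjective : ∀ a → ∃ λ i → π i ≡ a)
                 {f : Fin n → A} → (∀ {x y} → π x ≡ π y → f x ≡ f y) →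
                 f ≗ (λ a → f (proj₁ (surjective a))) ∘ π
factor-through {π = π} surjective f-respects i = f-respects (sym (proj₂ (surjective (π i))))

module Regluing {m n : ℕ} {G : Graph m} {H : Graph n} (H-balanced : ∀ j → indeg H j ≡ outdeg H j)
  {v₁ v₂ : Fin m} (v₁≢v₂ : v₁ ≢ v₂) {w₁ w₂ : Fin n} (w₁≢w₂ : w₁ ≢ w₂)
  {k k′} {π : Fin (m ℕ.+ n) → Fin k} {π′ : Fin (m ℕ.+ n) → Fin k′}
  (idπ : IsIdentification (v₁ ↑ˡ n) (m ↑ʳ w₁) (v₂ ↑ˡ n) (m ↑ʳ w₂) π)
  (idπ′ : IsIdentification (v₁ ↑ˡ n) (m ↑ʳ w₂) (v₂ ↑ˡ n) (m ↑ʳ w₁) π′) where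

  E : SplitEpi (m ℕ.+ n) k
  E = pushSplitEpi π (proj₁ idπ)

  E′ : SplitEpi (m ℕ.+ n) k′
  E′ = pushSplitEpi π′ (proj₁ idπ′)

  private
    P₁≢P₂ : v₁ ↑ˡ n ≢ v₂ ↑ˡ n
    P₁≢P₂ = v₁≢v₂ ∘ ↑ˡ-injective n v₁ v₂

    module I  = Identification (↑ˡ≢↑ʳ v₁ w₁) (↑ˡ≢↑ʳ v₂ w₂) P₁≢P₂ (↑ˡ≢↑ʳ v₁ w₂) (↑ˡ≢↑ʳ v₂ w₁) idπ
    module I′ = Identification (↑ˡ≢↑ʳ v₁ w₂) (↑ˡ≢↑ʳ v₂ w₁) P₁≢P₂ (↑ˡ≢↑ʳ v₁ w₁) (↑ˡ≢↑ʳ v₂ w₂) idπ′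

  reflect-maps-kernel : MapsKernel E E′ (reflectDiv v₁ v₂)
  reflect-maps-kernel d πd≗0 =
    I′.kernel⇒push≗0 (reflectDiv-kernel v₁ v₂ v₁≢v₂ w₁≢w₂ (I.push≗0⇒kernel πd≗0))

  reflect-maps-relations : MapsRelations (merge (G ⊕ H) π) (merge (G ⊕ H) π′) E E′ (reflectDiv v₁ v₂)
  reflect-maps-relations z = QT (G ⊕ H) u , QT-merge (G ⊕ H) π z , z′ , λ b → begin
    push π′ (reflectDiv v₁ v₂ (QT (G ⊕ H) u)) b  ≡⟨ P′.cong-≗ (reflectDiv-QT v₁ v₂ H-balanced c u) b ⟩
    push π′ (QT (G ⊕ H) (reflectPot m c u)) b    ≡⟨ P′.cong-≗ (IsLinear.cong-≗ (QT-linear (G ⊕ H)) descends) b ⟩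
    push π′ (QT (G ⊕ H) (z′ ∘ π′)) b             ≡⟨ QT-merge (G ⊕ H) π′ z′ b ⟨
    QT (merge (G ⊕ H) π′) z′ b                   ∎
    where
    module P′ = IsLinear (push-linear π′)
    u : ℤVec (m ℕ.+ n)
    u = z ∘ π
    c : ℤ
    c = u (m ↑ʳ w₁) + u (m ↑ʳ w₂)
    z′ : ℤVec k′
    z′ a = reflectPot m c u (proj₁ (proj₁ idπ′ a))
    descends : reflectPot m c u ≗ z′ ∘ π′
    descends = factor-through (proj₁ idπ′)
      (reflectPot-glue v₁ v₂ u (cong z (I.glued (inj₂ (inj₁ (refl , refl)))))
                               (cong z (I.glued (inj₂ (inj₂ (inj₂ (inj₁ (refl , refl))))))) ∘ I′.unglued)

corollary7p6 : ∀ {m n} (G : Graph m) (H : Graph n) → Balanced G → Balanced H →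
    (v₁ v₂ : Fin m) → v₁ ≢ v₂ → (w₁ w₂ : Fin n) → w₁ ≢ w₂ →
    ∀ {k k′} (π : Fin (m ℕ.+ n) → Fin k) (π′ : Fin (m ℕ.+ n) → Fin k′) →
    IsIdentification (v₁ ↑ˡ n) (m ↑ʳ w₁) (v₂ ↑ˡ n) (m ↑ʳ w₂) π →
    IsIdentification (v₁ ↑ˡ n) (m ↑ʳ w₂) (v₂ ↑ˡ n) (m ↑ʳ w₁) π′ →
    merge (G ⊕ H) π ≅K merge (G ⊕ H) π′
corollary7p6 G H _ (_ , H-balanced) v₁ v₂ v₁≢v₂ w₁ w₂ w₁≢w₂ π π′ idπ idπ′ =
  ≅K-via-automorphism F.E F.E′ (reflectDiv-linear v₁ v₂) (reflectDiv-linear v₁ v₂)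
    (reflectDiv-involutive v₁ v₂) (reflectDiv-involutive v₁ v₂)
    F.reflect-maps-kernel B.reflect-maps-kernel F.reflect-maps-relations B.reflect-maps-relations
  where
  module F = Regluing {G = G} H-balanced v₁≢v₂ w₁≢w₂ idπ idπ′
  module B = Regluing {G = G} H-balanced v₁≢v₂ (w₁≢w₂ ∘ sym) idπ′ idπ
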